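{- Let $T$ be a tournament of order $n\ge 3$. If there exists a vertex $u\in V(T)$ with $d^-(u)=0$, then $2\le\gamma_{oso}(T)\le\lceil\log_2(n-1)\rceil+1$.
   Context: A tournament is an orientation of a complete graph. $N^-(v)$ is the set of in-neighbors of $v$ and $d^-(v)=|N^-(v)|$. A set $S\subseteq V$ is out-dominating if every $v\in V\setminus S$ has an in-neighbor in $S$. $S$ is an out-secure out-dominating set (OSODS) if $S$ is out-dominating and for every $v\in V\setminus S$ there is $u\in N^-(v)\cap S$ such that $(S\setminus\{u\})\cup\{v\}$ is out-dominating. $\gamma_{oso}(T)$ is the minimum size of an OSODS of $T$. -}

module Defs where

open import Data.Nat using (ℕ; _≤_)
open import Data.Fin using (Fin)
open import Data.Fin.Subset using (Subset; _∈_; _∉_; _-_; _∪_; ⁅_⁆; ∣_∣)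
open import Data.Product using (Σ; ∃; _×_; _,_)
open import Data.Sum using (_⊎_)
open import Relation.Nullary using (¬_; Dec)
open import Relation.Binary.PropositionalEquality using (_≡_)

record Tournament (n : ℕ) : Set₁ where
  field
    _⇒_      : Fin n → Fin n → Set
    ⇒-dec    : ∀ u v → Dec (u ⇒ v)
    irrefl   : ∀ u → ¬ (u ⇒ u)
    total    : ∀ u v → ¬ (u ≡ v) → (u ⇒ v) ⊎ (v ⇒ u)
    antisym  : ∀ u v → u ⇒ v → ¬ (v ⇒ u)

module _ {n : ℕ} (T : Tournament n) where
  open Tournament T

  InDegreeZero : Fin n → Set
  InDegreeZero u = ∀ w → ¬ (w ⇒ u)

  OutDominating : Subset n → Set
  OutDominating S = ∀ v → v ∉ S → ∃ λ u → (u ∈ S) × (u ⇒ v)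

  OSODS : Subset n → Set
  OSODS S = OutDominating S ×
            (∀ v → v ∉ S → ∃ λ u → (u ∈ S) × (u ⇒ v) ×
                                   OutDominating ((S - u) ∪ ⁅ v ⁆))

  IsOSODSNumber : ℕ → Set
  IsOSODSNumber k = (∃ λ S → OSODS S × ∣ S ∣ ≡ k) × (∀ S → OSODS S → k ≤ ∣ S ∣)

module Submission where

-- A source u lies in every OSODS S (nothing else can dominate it), and any set containing u is
-- out-dominating. Hence S is an OSODS iff u ∈ S and every v ∉ S has an in-neighbour in S other
-- than u: swapping u itself out would leave u undominated. This forces a second vertex into S,
-- and conversely u together with a dominating set of T - u is an OSODS. Since T - u has n - 1
-- vertices, it remains to dominate m ≤ 2 ^ k vertices with k of them: in-degrees inside a
-- tournament average (m - 1) / 2, so some x has fewer than 2 ^ (k - 1) in-neighbours; x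
-- dominates every vertex other than itself and those, and we recurse on its in-neighbourhood.

open import Defs
open import Data.Nat
  using (ℕ; zero; suc; _+_; _*_; _^_; _∸_; _≤_; _<_; _≤?_; _≟_; z≤n; s≤s; ⌈_/2⌉; ⌊_/2⌋)
open import Data.Nat.Properties
open import Data.Nat.Induction using (<-rec)
open import Data.Nat.Logarithm using (⌈log₂_⌉; ⌈log₂⌉-mono-≤; ⌈log₂⌈n/2⌉⌉≡⌈log₂n⌉∸1)
open import Data.Nat.ListAction using (sum)
open import Data.Nat.Tactic.RingSolver using (solve-∀)
open import Algebra.Properties.CommutativeSemigroup +-commutativeSemigroup using (x∙yz≈y∙xz)
open import Data.Fin as Fin using (Fin; zero; suc)
open import Data.Fin.Properties using (any?; all?)
open import Data.Fin.Subset
  using (Subset; inside; outside; _∈_; _∉_; _-_; _∪_; ⁅_⁆; ∣_∣; _⊆_; ⊤) renaming (⊥ to ∅)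
open import Data.Fin.Subset.Properties
  using ( _∈?_; anySubset?; x∈p∪q⁺; x∈p∪q⁻; x∈⁅x⁆; x∈⁅y⁆⇒x≡y; ∣⊥∣≡0; ∣⁅x⁆∣≡1; ∣⊤∣≡n
        ; x∈p∧x≢y⇒x∈p-y; x∈p⇒∣p-x∣<∣p∣; p⊆q⇒∣p∣≤∣q∣)
open import Data.Vec.Base using ([]; _∷_; here; there)
open import Data.List using (List; []; _∷_; length; filter; foldr; map; allFin)
open import Data.List.Properties using (filter-notAll; length-tabulate)
open import Data.List.Membership.Propositional using (find; lose) renaming (_∈_ to _∈ˡ_)
open import Data.List.Membership.Propositional.Properties using (∈-filter⁺; ∈-filter⁻; ∈-allFin)
open import Data.List.Relation.Binary.Subset.Propositional using () renaming (_⊆_ to _⊆ˡ_)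
open import Data.List.Relation.Unary.All as All using (All; []; _∷_)
open import Data.List.Relation.Unary.All.Properties using (¬Any⇒All¬)
open import Data.List.Relation.Unary.Any using (Any; here; there) renaming (any? to anyˡ?)
open import Data.List.Relation.Unary.Unique.Propositional using (Unique; []; _∷_)
open import Data.List.Relation.Unary.Unique.Propositional.Properties using (allFin⁺; filter⁺)
open import Data.Empty using (⊥-elim)
open import Data.Product using (∃; _×_; _,_; proj₁; proj₂)
open import Data.Sum using (_⊎_; inj₁; inj₂; [_,_]′) renaming (map to map⊎)
open import Function using (id; _∘_)
open import Relation.Nullary using (¬_; yes; no; contradiction)
open import Relation.Nullary.Decidable using (¬?; _×-dec_; _→-dec_; decidable-stable)
open import Relation.Unary using (Decidable)
open import Relation.Binary.PropositionalEquality
  using (_≡_; _≢_; refl; sym; trans; cong; cong₂; subst; module ≡-Reasoning)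

n≤2*⌈n/2⌉ : ∀ n → n ≤ 2 * ⌈ n /2⌉
n≤2*⌈n/2⌉ n = begin
  n                  ≡⟨ sym (⌊n/2⌋+⌈n/2⌉≡n n) ⟩
  ⌊ n /2⌋ + ⌈ n /2⌉  ≤⟨ +-monoˡ-≤ ⌈ n /2⌉ (⌊n/2⌋≤⌈n/2⌉ n) ⟩
  ⌈ n /2⌉ + ⌈ n /2⌉  ≡⟨ cong (⌈ n /2⌉ +_) (sym (+-identityʳ ⌈ n /2⌉)) ⟩
  2 * ⌈ n /2⌉        ∎
  where open ≤-Reasoning

n≤2^⌈log₂n⌉ : ∀ n → n ≤ 2 ^ ⌈log₂ n ⌉
n≤2^⌈log₂n⌉ = <-rec _ bound
  where
  bound : ∀ n → (∀ {m} → m < n → m ≤ 2 ^ ⌈log₂ m ⌉) → n ≤ 2 ^ ⌈log₂ n ⌉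
  bound 0 _ = z≤n
  bound 1 _ = s≤s z≤n
  bound n@(suc (suc k)) rec = begin
    n                             ≤⟨ n≤2*⌈n/2⌉ n ⟩
    2 * ⌈ n /2⌉                   ≤⟨ *-monoʳ-≤ 2 (rec (⌈n/2⌉<n k)) ⟩
    2 ^ suc ⌈log₂ ⌈ n /2⌉ ⌉       ≡⟨ cong (λ e → 2 ^ suc e) (⌈log₂⌈n/2⌉⌉≡⌈log₂n⌉∸1 n) ⟩
    2 ^ (1 + (⌈log₂ n ⌉ ∸ 1))     ≡⟨ cong (2 ^_) (m+[n∸m]≡n (⌈log₂⌉-mono-≤ {2} {n} 2≤n)) ⟩
    2 ^ ⌈log₂ n ⌉                 ∎
    where
    open ≤-Reasoning
    2≤n : 2 ≤ n
    2≤n = s≤s (s≤s z≤n)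

2s+r≡r²⇒2[r+s]+[1+r]≡[1+r]² : ∀ r s → 2 * s + r ≡ r * r → 2 * (r + s) + suc r ≡ suc r * suc r
2s+r≡r²⇒2[r+s]+[1+r]≡[1+r]² r s 2s+r≡r² = begin
  2 * (r + s) + suc r        ≡⟨ regroup r s ⟩
  (2 * s + r) + (2 * r + 1)  ≡⟨ cong (_+ (2 * r + 1)) 2s+r≡r² ⟩
  r * r + (2 * r + 1)        ≡⟨ square-suc r ⟩
  suc r * suc r              ∎
  where
  open ≡-Reasoning
  regroup : ∀ r s → 2 * (r + s) + suc r ≡ (2 * s + r) + (2 * r + 1)
  regroup = solve-∀
  square-suc : ∀ r → r * r + (2 * r + 1) ≡ suc r * suc r
  square-suc = solve-∀

module _ {P : ℕ → Set} (P? : Decidable P) where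

  least-from : ∀ d i → (∀ {j} → j < i → ¬ P j) → P (d + i) →
               ∃ λ k → P k × (∀ {j} → P j → k ≤ j)
  least-from d i below Pd+i with P? i
  ... | yes Pi = i , Pi , λ Pj → ≮⇒≥ (λ j<i → below j<i Pj)
  least-from zero    i below Pi   | no ¬Pi = contradiction Pi ¬Pi
  least-from (suc d) i below Pd+i | no ¬Pi =
    least-from d (suc i) below′ (subst P (sym (+-suc d i)) Pd+i)
    where
    below′ : ∀ {j} → j < suc i → ¬ P j
    below′ j<1+i with m<1+n⇒m<n∨m≡n j<1+i
    ... | inj₁ j<i  = below j<i
    ... | inj₂ refl = ¬Pi

  least : ∀ {b} → P b → ∃ λ k → P k × (∀ {j} → P j → k ≤ j)
  least {b} Pb = least-from b 0 (λ ()) (subst P (sym (+-identityʳ b)) Pb)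

∣p∪q∣≤∣p∣+∣q∣ : ∀ {n} (p q : Subset n) → ∣ p ∪ q ∣ ≤ ∣ p ∣ + ∣ q ∣
∣p∪q∣≤∣p∣+∣q∣ []            []            = z≤n
∣p∪q∣≤∣p∣+∣q∣ (inside  ∷ p) (inside  ∷ q) =
  s≤s (≤-trans (∣p∪q∣≤∣p∣+∣q∣ p q) (+-monoʳ-≤ ∣ p ∣ (n≤1+n ∣ q ∣)))
∣p∪q∣≤∣p∣+∣q∣ (inside  ∷ p) (outside ∷ q) = s≤s (∣p∪q∣≤∣p∣+∣q∣ p q)
∣p∪q∣≤∣p∣+∣q∣ (outside ∷ p) (inside  ∷ q) =
  ≤-trans (s≤s (∣p∪q∣≤∣p∣+∣q∣ p q)) (≤-reflexive (sym (+-suc ∣ p ∣ ∣ q ∣)))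
∣p∪q∣≤∣p∣+∣q∣ (outside ∷ p) (outside ∷ q) = ∣p∪q∣≤∣p∣+∣q∣ p q

x∈p∧y∈p∧x≢y⇒2≤∣p∣ : ∀ {n} {p : Subset n} {x y} → x ∈ p → y ∈ p → x ≢ y → 2 ≤ ∣ p ∣
x∈p∧y∈p∧x≢y⇒2≤∣p∣ {p = p} {x} {y} x∈p y∈p x≢y = begin
  2              ≡⟨ cong suc (sym (∣⁅x⁆∣≡1 y)) ⟩
  suc ∣ ⁅ y ⁆ ∣  ≤⟨ s≤s (p⊆q⇒∣p∣≤∣q∣ ⁅y⁆⊆p-x) ⟩
  suc ∣ p - x ∣  ≤⟨ x∈p⇒∣p-x∣<∣p∣ x∈p ⟩
  ∣ p ∣          ∎
  where
  open ≤-Reasoning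
  ⁅y⁆⊆p-x : ⁅ y ⁆ ⊆ p - x
  ⁅y⁆⊆p-x z∈⁅y⁆ with x∈⁅y⁆⇒x≡y y z∈⁅y⁆
  ... | refl = x∈p∧x≢y⇒x∈p-y y∈p (x≢y ∘ sym)

x∉p-x : ∀ {n} (p : Subset n) x → x ∉ p - x
x∉p-x (inside  ∷ p) zero    ()
x∉p-x (outside ∷ p) zero    ()
x∉p-x (_       ∷ p) (suc x) (there x∈p-x) = x∉p-x p x x∈p-x

fromList : ∀ {n} → List (Fin n) → Subset n
fromList = foldr (λ x p → ⁅ x ⁆ ∪ p) ∅

∣fromList∣≤length : ∀ {n} (xs : List (Fin n)) → ∣ fromList xs ∣ ≤ length xs
∣fromList∣≤length {n} [] = ≤-reflexive (∣⊥∣≡0 n)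
∣fromList∣≤length (x ∷ xs) = begin
  ∣ ⁅ x ⁆ ∪ fromList xs ∣        ≤⟨ ∣p∪q∣≤∣p∣+∣q∣ ⁅ x ⁆ (fromList xs) ⟩
  ∣ ⁅ x ⁆ ∣ + ∣ fromList xs ∣    ≤⟨ +-mono-≤ (≤-reflexive (∣⁅x⁆∣≡1 x)) (∣fromList∣≤length xs) ⟩
  suc (length xs)                ∎
  where open ≤-Reasoning

∈-fromList⁺ : ∀ {n} {x : Fin n} {xs} → x ∈ˡ xs → x ∈ fromList xs
∈-fromList⁺ (here refl) = x∈p∪q⁺ (inj₁ (x∈⁅x⁆ _))
∈-fromList⁺ (there x∈xs) = x∈p∪q⁺ (inj₂ (∈-fromList⁺ x∈xs))

∃-minimumSize : ∀ {n} {Q : Subset n → Set} → Decidable Q → ∀ {S} → Q S →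
  ∃ λ k → (∃ λ S → Q S × ∣ S ∣ ≡ k) × (∀ S → Q S → k ≤ ∣ S ∣)
∃-minimumSize Q? {S} QS =
  let k , witness , minimal = least hasSize? (S , QS , refl)
  in  k , witness , λ S′ QS′ → minimal (S′ , QS′ , refl)
  where
  hasSize? : Decidable (λ k → ∃ λ S → _ × ∣ S ∣ ≡ k)
  hasSize? k = anySubset? (λ S → Q? S ×-dec (∣ S ∣ ≟ k))

All[c≤k*f]⇒length*c≤k*sum : ∀ {A : Set} {c} k (f : A → ℕ) L →
  All (λ x → c ≤ k * f x) L → length L * c ≤ k * sum (map f L)
All[c≤k*f]⇒length*c≤k*sum k f [] [] = z≤n
All[c≤k*f]⇒length*c≤k*sum {c = c} k f (x ∷ L) (c≤kfx ∷ rest) = begin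
  c + length L * c             ≤⟨ +-mono-≤ c≤kfx (All[c≤k*f]⇒length*c≤k*sum k f L rest) ⟩
  k * f x + k * sum (map f L)  ≡⟨ sym (*-distribˡ-+ k (f x) (sum (map f L))) ⟩
  k * sum (map f (x ∷ L))      ∎
  where open ≤-Reasoning

module TournamentProperties {n : ℕ} (T : Tournament n) where
  open Tournament T

  inNbrs : Fin n → List (Fin n) → List (Fin n)
  inNbrs x = filter (λ w → ⇒-dec w x)

  inDeg : Fin n → List (Fin n) → ℕ
  inDeg x R = length (inNbrs x R)

  outDeg : Fin n → List (Fin n) → ℕ
  outDeg y R = length (filter (⇒-dec y) R)

  inDegSum : List (Fin n) → List (Fin n) → ℕ
  inDegSum L R = sum (map (λ x → inDeg x R) L)

  inDeg+outDeg≡length : ∀ {y} R → All (y ≢_) R → inDeg y R + outDeg y R ≡ length R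
  inDeg+outDeg≡length [] [] = refl
  inDeg+outDeg≡length {y} (w ∷ R) (y≢w ∷ y∉R) with ⇒-dec w y | ⇒-dec y w
  ... | yes w⇒y | yes y⇒w = ⊥-elim (antisym w y w⇒y y⇒w)
  ... | yes _   | no _    = cong suc (inDeg+outDeg≡length R y∉R)
  ... | no _    | yes _   = trans (+-suc _ _) (cong suc (inDeg+outDeg≡length R y∉R))
  ... | no w⇏y  | no y⇏w  = ⊥-elim ([ y⇏w , w⇏y ]′ (total y w y≢w))

  inDeg-∷-self : ∀ y R → inDeg y (y ∷ R) ≡ inDeg y R
  inDeg-∷-self y R with ⇒-dec y y
  ... | yes y⇒y = ⊥-elim (irrefl y y⇒y)
  ... | no _    = refl

  inDegSum-∷ʳ : ∀ y L R → inDegSum L (y ∷ R) ≡ outDeg y L + inDegSum L R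
  inDegSum-∷ʳ y [] R = refl
  inDegSum-∷ʳ y (x ∷ L) R with ⇒-dec y x
  ... | yes _ = cong suc (trans (cong (inDeg x R +_) (inDegSum-∷ʳ y L R))
                                (x∙yz≈y∙xz (inDeg x R) (outDeg y L) (inDegSum L R)))
  ... | no _  = trans (cong (inDeg x R +_) (inDegSum-∷ʳ y L R))
                      (x∙yz≈y∙xz (inDeg x R) (outDeg y L) (inDegSum L R))

  2*inDegSum+length≡length² : ∀ R → Unique R → 2 * inDegSum R R + length R ≡ length R * length R
  2*inDegSum+length≡length² [] [] = refl
  2*inDegSum+length≡length² (y ∷ R) (y∉R ∷ uniq) = begin
    2 * inDegSum (y ∷ R) (y ∷ R) + suc r  ≡⟨ cong (λ s → 2 * s + suc r) inDegSum-cons ⟩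
    2 * (r + s) + suc r
      ≡⟨ 2s+r≡r²⇒2[r+s]+[1+r]≡[1+r]² r s (2*inDegSum+length≡length² R uniq) ⟩
    suc r * suc r                         ∎
    where
    open ≡-Reasoning
    r = length R
    s = inDegSum R R
    inDegSum-cons : inDegSum (y ∷ R) (y ∷ R) ≡ r + s
    inDegSum-cons = begin
      inDeg y (y ∷ R) + inDegSum R (y ∷ R)  ≡⟨ cong₂ _+_ (inDeg-∷-self y R) (inDegSum-∷ʳ y R R) ⟩
      inDeg y R + (outDeg y R + s)          ≡⟨ sym (+-assoc (inDeg y R) _ _) ⟩
      (inDeg y R + outDeg y R) + s          ≡⟨ cong (_+ s) (inDeg+outDeg≡length R y∉R) ⟩
      r + s                                 ∎

  ∃-lowInDeg : ∀ R → Unique R → 1 ≤ length R → ∃ λ x → x ∈ˡ R × suc (2 * inDeg x R) ≤ length R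
  ∃-lowInDeg R uniq 1≤r with anyˡ? (λ x → suc (2 * inDeg x R) ≤? length R) R
  ... | yes low = find low
  ... | no ¬low = ⊥-elim (<⇒≱ 1≤r (+-cancelˡ-≤ (2 * s) r 0 2s+r≤2s+0))
    where
    r = length R
    s = inDegSum R R
    r²≤2s : r * r ≤ 2 * s
    r²≤2s = All[c≤k*f]⇒length*c≤k*sum 2 (λ x → inDeg x R) R (All.map ≮⇒≥ (¬Any⇒All¬ R ¬low))
    2s+r≤2s+0 : 2 * s + r ≤ 2 * s + 0
    2s+r≤2s+0 = begin
      2 * s + r  ≡⟨ 2*inDegSum+length≡length² R uniq ⟩
      r * r      ≤⟨ r²≤2s ⟩
      2 * s      ≡⟨ sym (+-identityʳ (2 * s)) ⟩
      2 * s + 0  ∎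
      where open ≤-Reasoning

  Dominates : List (Fin n) → List (Fin n) → Set
  Dominates D R = ∀ {v} → v ∈ˡ R → v ∈ˡ D ⊎ ∃ λ d → d ∈ˡ D × d ⇒ v

  DominatingSublist : ℕ → List (Fin n) → Set
  DominatingSublist k R = ∃ λ D → length D ≤ k × D ⊆ˡ R × Dominates D R

  dominatingSublist-∷ : ∀ {k x R} → x ∈ˡ R → DominatingSublist k (inNbrs x R) →
                        DominatingSublist (suc k) R
  dominatingSublist-∷ {x = x} {R} x∈R (D , |D|≤k , D⊆inNbrs , dom) =
    x ∷ D , s≤s |D|≤k , x∷D⊆R , x∷D-dominates
    where
    x∷D⊆R : x ∷ D ⊆ˡ R
    x∷D⊆R (here refl)  = x∈R
    x∷D⊆R (there d∈D) = proj₁ (∈-filter⁻ (λ w → ⇒-dec w x) (D⊆inNbrs d∈D))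
    x∷D-dominates : Dominates (x ∷ D) R
    x∷D-dominates {v} v∈R with v Fin.≟ x
    ... | yes refl = inj₁ (here refl)
    ... | no v≢x with ⇒-dec v x
    ... | yes v⇒x = map⊎ there (λ (d , d∈D , d⇒v) → d , there d∈D , d⇒v)
                         (dom (∈-filter⁺ (λ w → ⇒-dec w x) v∈R v⇒x))
    ... | no v⇏x  = inj₂ (x , here refl , [ id , ⊥-elim ∘ v⇏x ]′ (total x v (v≢x ∘ sym)))

  dominatingSublist-< : ∀ k R → Unique R → length R < 2 ^ k → DominatingSublist k R
  dominatingSublist-≤ : ∀ {k} R → Unique R → 1 ≤ k → length R ≤ 2 ^ k → DominatingSublist k R

  dominatingSublist-< zero    []      _    _             = [] , z≤n , (λ ()) , (λ ())
  dominatingSublist-< zero    (_ ∷ _) _    (s≤s ())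
  dominatingSublist-< (suc k) R       uniq |R|<2^[1+k] =
    dominatingSublist-≤ R uniq (s≤s z≤n) (<⇒≤ |R|<2^[1+k])

  dominatingSublist-≤ [] _ _ _ = [] , z≤n , (λ ()) , (λ ())
  dominatingSublist-≤ {suc k} R@(_ ∷ _) uniq _ |R|≤2^[1+k] with ∃-lowInDeg R uniq (s≤s z≤n)
  ... | x , x∈R , lowInDeg = dominatingSublist-∷ x∈R
    (dominatingSublist-< k (inNbrs x R) (filter⁺ (λ w → ⇒-dec w x) uniq)
      (*-cancelˡ-< 2 (inDeg x R) (2 ^ k) (≤-trans lowInDeg |R|≤2^[1+k])))

  outDominating? : Decidable (OutDominating T)
  outDominating? S = all? (λ v → ¬? (v ∈? S) →-dec any? (λ w → (w ∈? S) ×-dec ⇒-dec w v))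

  osods? : Decidable (OSODS T)
  osods? S = outDominating? S ×-dec all? (λ v → ¬? (v ∈? S) →-dec
               any? (λ w → (w ∈? S) ×-dec (⇒-dec w v ×-dec outDominating? ((S - w) ∪ ⁅ v ⁆))))

module SourceVertex {n : ℕ} (T : Tournament n) {u : Fin n} (source : InDegreeZero T u) where
  open Tournament T
  open TournamentProperties T

  ∋source⇒outDominating : ∀ {S} → u ∈ S → OutDominating T S
  ∋source⇒outDominating {S} u∈S v v∉S with total u v (λ u≡v → v∉S (subst (_∈ S) u≡v u∈S))
  ... | inj₁ u⇒v = u , u∈S , u⇒v
  ... | inj₂ v⇒u = ⊥-elim (source v v⇒u)

  source∈OSODS : ∀ {S} → OSODS T S → u ∈ S
  source∈OSODS {S} (dominating , _) with u ∈? S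
  ... | yes u∈S = u∈S
  ... | no u∉S  = let w , _ , w⇒u = dominating u u∉S in ⊥-elim (source w w⇒u)

  DominatedAvoidingSource : Subset n → Set
  DominatedAvoidingSource S = ∀ v → v ∉ S → ∃ λ w → w ∈ S × w ≢ u × w ⇒ v

  -- Swapping u out would leave u itself undominated, so the secure dominator is never u.
  OSODS⇒dominatedAvoidingSource : ∀ {S} → OSODS T S → DominatedAvoidingSource S
  OSODS⇒dominatedAvoidingSource {S} osods@(_ , secure) v v∉S with secure v v∉S
  ... | w , w∈S , w⇒v , swapDominating with w Fin.≟ u
  ... | no w≢u   = w , w∈S , w≢u , w⇒v
  ... | yes refl = let x , _ , x⇒u = swapDominating u u∉swap in ⊥-elim (source x x⇒u)
    where
    u∉swap : u ∉ (S - u) ∪ ⁅ v ⁆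
    u∉swap u∈swap with x∈p∪q⁻ (S - u) ⁅ v ⁆ u∈swap
    ... | inj₁ u∈S-u = x∉p-x S u u∈S-u
    ... | inj₂ u∈⁅v⁆ = v∉S (subst (_∈ S) (x∈⁅y⁆⇒x≡y v u∈⁅v⁆) (source∈OSODS osods))

  dominatedAvoidingSource⇒OSODS : ∀ {S} → u ∈ S → DominatedAvoidingSource S → OSODS T S
  dominatedAvoidingSource⇒OSODS u∈S avoiding = ∋source⇒outDominating u∈S , λ v v∉S →
    let w , w∈S , w≢u , w⇒v = avoiding v v∉S
    in  w , w∈S , w⇒v , ∋source⇒outDominating (x∈p∪q⁺ (inj₁ (x∈p∧x≢y⇒x∈p-y u∈S (w≢u ∘ sym))))

  2≤∣OSODS∣ : 2 ≤ n → ∀ {S} → OSODS T S → 2 ≤ ∣ S ∣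
  2≤∣OSODS∣ 2≤n {S} osods with any? (λ v → ¬? (v ∈? S))
  ... | yes (v , v∉S) =
    let w , w∈S , w≢u , _ = OSODS⇒dominatedAvoidingSource osods v v∉S
    in  x∈p∧y∈p∧x≢y⇒2≤∣p∣ w∈S (source∈OSODS osods) w≢u
  ... | no ∄v∉S = begin
    2          ≤⟨ 2≤n ⟩
    n          ≡⟨ sym (∣⊤∣≡n n) ⟩
    ∣ ⊤ {n} ∣  ≤⟨ p⊆q⇒∣p∣≤∣q∣ {p = ⊤} (λ {v} _ → decidable-stable (v ∈? S) (∄v∉S ∘ (v ,_))) ⟩
    ∣ S ∣      ∎
    where open ≤-Reasoning

  ≢source? : Decidable (_≢ u)
  ≢source? v = ¬? (v Fin.≟ u)

  otherVertices : List (Fin n)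
  otherVertices = filter ≢source? (allFin n)

  length-otherVertices : length otherVertices ≤ n ∸ 1
  length-otherVertices =
    subst (length otherVertices ≤_) (pred[m∸n]≡m∸[1+n] n 0) (<⇒≤pred (begin-strict
      length otherVertices  <⟨ filter-notAll ≢source? (allFin n) source-rejected ⟩
      length (allFin n)     ≡⟨ length-tabulate id ⟩
      n                     ∎))
    where
    open ≤-Reasoning
    source-rejected : Any (λ v → ¬ v ≢ u) (allFin n)
    source-rejected = lose (∈-allFin u) (λ u≢u → u≢u refl)

  OSODS-fromDominatingSublist : ∀ {k} → DominatingSublist k otherVertices →
                                ∃ λ S → OSODS T S × ∣ S ∣ ≤ suc k
  OSODS-fromDominatingSublist (D , |D|≤k , D⊆otherVertices , dominates) =
    S , dominatedAvoidingSource⇒OSODS u∈S avoiding , ≤-trans (∣fromList∣≤length (u ∷ D)) (s≤s |D|≤k)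
    where
    S = fromList (u ∷ D)
    u∈S : u ∈ S
    u∈S = ∈-fromList⁺ {xs = u ∷ D} (here refl)
    D⊆S : ∀ {d} → d ∈ˡ D → d ∈ S
    D⊆S d∈D = ∈-fromList⁺ {xs = u ∷ D} (there d∈D)
    avoiding : DominatedAvoidingSource S
    avoiding v v∉S with dominates (∈-filter⁺ ≢source? (∈-allFin v) (λ { refl → v∉S u∈S }))
    ... | inj₁ v∈D = ⊥-elim (v∉S (D⊆S v∈D))
    ... | inj₂ (d , d∈D , d⇒v) =
      d , D⊆S d∈D , proj₂ (∈-filter⁻ ≢source? {xs = allFin n} (D⊆otherVertices d∈D)) , d⇒v

  ∃-OSODS-≤⌈log₂[n-1]⌉+1 : 3 ≤ n → ∃ λ S → OSODS T S × ∣ S ∣ ≤ ⌈log₂ (n ∸ 1) ⌉ + 1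
  ∃-OSODS-≤⌈log₂[n-1]⌉+1 3≤n =
    let S , osods , |S|≤1+L = OSODS-fromDominatingSublist
          (dominatingSublist-≤ otherVertices (filter⁺ ≢source? (allFin⁺ n)) 1≤L
            (≤-trans length-otherVertices (n≤2^⌈log₂n⌉ (n ∸ 1))))
    in  S , osods , subst (∣ S ∣ ≤_) (+-comm 1 L) |S|≤1+L
    where
    L = ⌈log₂ (n ∸ 1) ⌉
    1≤L : 1 ≤ L
    1≤L = ⌈log₂⌉-mono-≤ {2} (∸-monoˡ-≤ 1 3≤n)

proposition2p12 : (n : ℕ) → 3 ≤ n → (T : Tournament n) →
    (∃ λ u → InDegreeZero T u) →
    ∃ λ k → IsOSODSNumber T k × 2 ≤ k × k ≤ ⌈log₂ (n ∸ 1) ⌉ + 1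
proposition2p12 n 3≤n T (_ , source) =
  let open SourceVertex T source
      S , osods , |S|≤bound = ∃-OSODS-≤⌈log₂[n-1]⌉+1 3≤n
      k , (S₀ , osods₀ , |S₀|≡k) , minimal = ∃-minimumSize (osods? T) osods
  in  k , ((S₀ , osods₀ , |S₀|≡k) , minimal) ,
      subst (2 ≤_) |S₀|≡k (2≤∣OSODS∣ (<⇒≤ 3≤n) osods₀) ,
      ≤-trans (minimal S osods) |S|≤bound
  where open TournamentProperties using (osods?)
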